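{- Let the rational functions $\overline{P}_k(q)$, $k\ge1$, be defined by $\overline{P}_1(q)=1$ and, for $k>1$, \[ \overline{P}_k(q)=\frac{(q^{k-1}-1)\overline{P}_{k-1}(q)+q^{k-1}(1+q)}{1+q^k}. \] Then for every positive integer $k$, \[ \overline{P}_{k}(q)=\frac{q^{k-1}(1+q)}{1+q^{k}}-\frac{(q;q)_{k-1}}{(-q^2;q)_{k-1}}\sum_{j=0}^{k-2}(-1)^jq^{k-j-2}\frac{(-q;q)_{k-j-2}}{(q;q)_{k-j-2}}. \]
   Context: Notation: $(a;q)_N=\prod_{j=0}^{N-1}(1-aq^j)$, with $(a;q)_0=1$; an empty sum equals $0$. -}

module Defs where

open import Data.Nat using (ℕ; zero; suc)
open import Data.Rational using (ℚ; 0ℚ; 1ℚ; _+_; _*_; _-_; -_; _÷_; ≢-nonZero)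
open import Data.Rational.Properties using (_≟_)
open import Relation.Nullary using (yes; no)

infixr 8 _^_
_^_ : ℚ → ℕ → ℚ
q ^ zero  = 1ℚ
q ^ suc n = q * q ^ n

-- Total division: p ⊘ r = p / r when r ≠ 0 (and 0 when r = 0; this
-- case never arises under the hypotheses of the theorem).
infixl 7 _⊘_
_⊘_ : ℚ → ℚ → ℚ
p ⊘ r with r ≟ 0ℚ
... | yes _  = 0ℚ
... | no r≢0 = _÷_ p r {{≢-nonZero r≢0}}

poch : ℚ → ℚ → ℕ → ℚ
poch a q zero    = 1ℚ
poch a q (suc N) = poch a q N * (1ℚ - a * q ^ N)

-- Pbar q k  represents  \overline{P}_{k+1}(q)  (shifted index, k ≥ 0)
-- Pbar_1 = 1;  Pbar_k = ((q^{k-1}-1) Pbar_{k-1} + q^{k-1}(1+q)) / (1+q^k)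
Pbar : ℚ → ℕ → ℚ
Pbar q zero    = 1ℚ
Pbar q (suc m) =
  ((q ^ suc m - 1ℚ) * Pbar q m + q ^ suc m * (1ℚ + q)) ⊘ (1ℚ + q ^ suc (suc m))

sgn : ℕ → ℚ
sgn zero    = 1ℚ
sgn (suc j) = - sgn j

Σ< : ℕ → (ℕ → ℚ) → ℚ
Σ< zero    f = 0ℚ
Σ< (suc n) f = Σ< n f + f n

{-# OPTIONS --safe #-}
-- With n = k - 1, write the right-hand side as lead n - coeff n * altSum n, and let
-- ratio m = (-q;q)_m / (q;q)_m be the quotient inside the sum.  Peeling off the j = 0 term gives
-- altSum (n+1) = q^n ratio n - altSum n; the Pochhammer symbols give
-- coeff (n+1) (1 + q^(n+2)) = coeff n (1 - q^(n+1)) and, since (-q;q)_(n+1) = (1+q) (-q²;q)_n,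
-- coeff n q^n ratio n = lead n.  Hence the right-hand side obeys the recurrence defining P̄,
-- and the two agree by induction.  The hypotheses q ≠ ±1 keep every denominator, a product of
-- factors 1 ± q^m with m ≥ 1, nonzero.

module Submission where

open import Defs
open import Algebra.Bundles using (CommutativeMonoid)
open import Data.Empty using (⊥-elim)
open import Data.Nat using (ℕ; zero; suc; _∸_; _≤_; s≤s)
open import Data.Rational
  using (ℚ; 0ℚ; 1ℚ; _+_; _*_; _-_; -_; 1/_; ≢-nonZero; ∣_∣; NonNegative)
  renaming (_≤_ to _≤ℚ_)
open import Data.Rational.Properties
  using (_≟_; +-0-group; +-*-commutativeRing; *-1-commutativeMonoid; +-comm; +-assoc;
         neg-distrib-+; *-assoc; *-comm;
         *-identityʳ; *-zeroˡ; *-inverseˡ; *-inverseʳ; ∣p∣≡p∨∣p∣≡-p; ∣p*q∣≡∣p∣*∣q∣;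
         ∣-∣-nonNeg; *-monoˡ-≤-nonNeg; ≤-refl; <⇒≤; <-cmp; <-irrefl; module ≤-Reasoning)
open import Data.Sum using (inj₁; inj₂)
open import Relation.Binary.Definitions using (tri<; tri≈; tri>)
open import Relation.Binary.PropositionalEquality
  using (_≡_; _≢_; refl; sym; trans; cong; cong₂; module ≡-Reasoning)
open import Relation.Nullary using (yes; no)
open import Relation.Nullary.Decidable using (dec⇒maybe)
open import Tactic.RingSolver using (solve-∀)
open import Tactic.RingSolver.Core.AlmostCommutativeRing
  using (AlmostCommutativeRing; fromCommutativeRing)

open import Algebra.Properties.Group +-0-group using (x∙y⁻¹≈ε⇒x≈y; inverseʳ-unique; ⁻¹-involutive)
open import Algebra.Properties.CommutativeSemigroup
  (CommutativeMonoid.commutativeSemigroup *-1-commutativeMonoid) using (xy∙z≈xz∙y; xy∙z≈y∙xz)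

ℚ-ring : AlmostCommutativeRing _ _
ℚ-ring = fromCommutativeRing +-*-commutativeRing (λ p → dec⇒maybe (0ℚ ≟ p))

*-cancelʳ-≡ : ∀ {p u} r → r ≢ 0ℚ → p * r ≡ u * r → p ≡ u
*-cancelʳ-≡ {p} {u} r r≢0 eq = trans (sym (undo p)) (trans (cong (_* 1/ r) eq) (undo u))
  where
  instance _ = ≢-nonZero r≢0
  undo : ∀ x → x * r * 1/ r ≡ x
  undo x = trans (*-assoc x r (1/ r)) (trans (cong (x *_) (*-inverseʳ r)) (*-identityʳ x))

*-≢0 : ∀ {p u} → p ≢ 0ℚ → u ≢ 0ℚ → p * u ≢ 0ℚ
*-≢0 {p} {u} p≢0 u≢0 pu≡0 = p≢0 (*-cancelʳ-≡ u u≢0 (trans pu≡0 (sym (*-zeroˡ u))))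

p⊘r*r≡p : ∀ p {r} → r ≢ 0ℚ → p ⊘ r * r ≡ p
p⊘r*r≡p p {r} r≢0 with r ≟ 0ℚ
... | yes r≡0 = ⊥-elim (r≢0 r≡0)
... | no  _   = trans (*-assoc p (1/ r) r) (trans (cong (p *_) (*-inverseˡ r)) (*-identityʳ p))
  where instance _ = ≢-nonZero r≢0

⊘-unique : ∀ {p r y} → r ≢ 0ℚ → y * r ≡ p → p ⊘ r ≡ y
⊘-unique {p} r≢0 eq = *-cancelʳ-≡ _ r≢0 (trans (p⊘r*r≡p p r≢0) (sym eq))

⊘-cross : ∀ {p r u s} → r ≢ 0ℚ → s ≢ 0ℚ → p * s ≡ u * r → p ⊘ r ≡ u ⊘ s
⊘-cross {p} {r} {u} {s} r≢0 s≢0 eq = sym (⊘-unique s≢0 (*-cancelʳ-≡ r r≢0 (begin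
  p ⊘ r * s * r   ≡⟨ xy∙z≈xz∙y (p ⊘ r) s r ⟩
  p ⊘ r * r * s   ≡⟨ cong (_* s) (p⊘r*r≡p p r≢0) ⟩
  p * s           ≡⟨ eq ⟩
  u * r           ∎)))
  where open ≡-Reasoning

p⊘r*u⊘p≡u⊘r : ∀ {p r} u → p ≢ 0ℚ → r ≢ 0ℚ → p ⊘ r * (u ⊘ p) ≡ u ⊘ r
p⊘r*u⊘p≡u⊘r {p} {r} u p≢0 r≢0 = sym (⊘-unique r≢0 (begin
  p ⊘ r * (u ⊘ p) * r   ≡⟨ xy∙z≈xz∙y (p ⊘ r) (u ⊘ p) r ⟩
  p ⊘ r * r * (u ⊘ p)   ≡⟨ cong (_* (u ⊘ p)) (p⊘r*r≡p p r≢0) ⟩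
  p * (u ⊘ p)           ≡⟨ *-comm p (u ⊘ p) ⟩
  u ⊘ p * p             ≡⟨ p⊘r*r≡p u p≢0 ⟩
  u                     ∎))
  where open ≡-Reasoning

p*[u⊘r]≡p*u⊘r : ∀ p u {r} → r ≢ 0ℚ → p * (u ⊘ r) ≡ (p * u) ⊘ r
p*[u⊘r]≡p*u⊘r p u {r} r≢0 =
  sym (⊘-unique r≢0 (trans (*-assoc p (u ⊘ r) r) (cong (p *_) (p⊘r*r≡p u r≢0))))

p*a⊘r*b*b≡p⊘r*a : ∀ p a {r b} → r ≢ 0ℚ → r * b ≢ 0ℚ → (p * a) ⊘ (r * b) * b ≡ p ⊘ r * a
p*a⊘r*b*b≡p⊘r*a p a {r} {b} r≢0 rb≢0 = *-cancelʳ-≡ r r≢0 (begin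
  (p * a) ⊘ (r * b) * b * r   ≡⟨ *-assoc ((p * a) ⊘ (r * b)) b r ⟩
  (p * a) ⊘ (r * b) * (b * r) ≡⟨ cong ((p * a) ⊘ (r * b) *_) (*-comm b r) ⟩
  (p * a) ⊘ (r * b) * (r * b) ≡⟨ p⊘r*r≡p (p * a) rb≢0 ⟩
  p * a                       ≡⟨ cong (_* a) (sym (p⊘r*r≡p p r≢0)) ⟩
  p ⊘ r * r * a               ≡⟨ xy∙z≈xz∙y (p ⊘ r) r a ⟩
  p ⊘ r * a * r               ∎)
  where open ≡-Reasoning

∣p^n∣≡∣p∣^n : ∀ p n → ∣ p ^ n ∣ ≡ ∣ p ∣ ^ n
∣p^n∣≡∣p∣^n p zero    = refl
∣p^n∣≡∣p∣^n p (suc n) = trans (∣p*q∣≡∣p∣*∣q∣ p (p ^ n)) (cong (∣ p ∣ *_) (∣p^n∣≡∣p∣^n p n))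

module _ (x : ℚ) .{{_ : NonNegative x}} where
  open ≤-Reasoning

  x≤1⇒x^n≤1 : x ≤ℚ 1ℚ → ∀ n → x ^ n ≤ℚ 1ℚ
  x≤1⇒x^n≤1 x≤1 zero    = ≤-refl
  x≤1⇒x^n≤1 x≤1 (suc n) = begin
    x * x ^ n  ≤⟨ *-monoˡ-≤-nonNeg x (x≤1⇒x^n≤1 x≤1 n) ⟩
    x * 1ℚ     ≡⟨ *-identityʳ x ⟩
    x          ≤⟨ x≤1 ⟩
    1ℚ         ∎

  1≤x⇒1≤x^n : 1ℚ ≤ℚ x → ∀ n → 1ℚ ≤ℚ x ^ n
  1≤x⇒1≤x^n 1≤x zero    = ≤-refl
  1≤x⇒1≤x^n 1≤x (suc n) = begin
    1ℚ         ≤⟨ 1≤x ⟩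
    x          ≡⟨ *-identityʳ x ⟨
    x * 1ℚ     ≤⟨ *-monoˡ-≤-nonNeg x (1≤x⇒1≤x^n 1≤x n) ⟩
    x * x ^ n  ∎

  x^[1+n]≡1⇒x≡1 : ∀ n → x ^ suc n ≡ 1ℚ → x ≡ 1ℚ
  x^[1+n]≡1⇒x≡1 n x^[1+n]≡1 with <-cmp x 1ℚ
  ... | tri≈ _ x≡1 _ = x≡1
  ... | tri< x<1 _ _ = ⊥-elim (<-irrefl x^[1+n]≡1 (begin-strict
    x * x ^ n  ≤⟨ *-monoˡ-≤-nonNeg x (x≤1⇒x^n≤1 (<⇒≤ x<1) n) ⟩
    x * 1ℚ     ≡⟨ *-identityʳ x ⟩
    x          <⟨ x<1 ⟩
    1ℚ         ∎))
  ... | tri> _ _ 1<x = ⊥-elim (<-irrefl (sym x^[1+n]≡1) (begin-strict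
    1ℚ         <⟨ 1<x ⟩
    x          ≡⟨ *-identityʳ x ⟨
    x * 1ℚ     ≤⟨ *-monoˡ-≤-nonNeg x (1≤x⇒1≤x^n (<⇒≤ 1<x) n) ⟩
    x * x ^ n  ∎))

Σ<-cong : ∀ n {f g : ℕ → ℚ} → (∀ j → f j ≡ g j) → Σ< n f ≡ Σ< n g
Σ<-cong zero    f≗g = refl
Σ<-cong (suc n) f≗g = cong₂ _+_ (Σ<-cong n f≗g) (f≗g n)

Σ<-neg : ∀ n (f : ℕ → ℚ) → Σ< n (λ j → - f j) ≡ - Σ< n f
Σ<-neg zero    f = refl
Σ<-neg (suc n) f = trans (cong (_+ - f n) (Σ<-neg n f)) (sym (neg-distrib-+ (Σ< n f) (f n)))

Σ<-suc : ∀ n (f : ℕ → ℚ) → Σ< (suc n) f ≡ f 0 + Σ< n (λ j → f (suc j))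
Σ<-suc zero    f = +-comm 0ℚ (f 0)
Σ<-suc (suc n) f = trans (cong (_+ f (suc n)) (Σ<-suc n f)) (+-assoc (f 0) _ (f (suc n)))

poch-≢0 : ∀ {a q} → (∀ j → 1ℚ - a * q ^ j ≢ 0ℚ) → ∀ n → poch a q n ≢ 0ℚ
poch-≢0 factor≢0 zero    ()
poch-≢0 factor≢0 (suc n) = *-≢0 (poch-≢0 factor≢0 n) (factor≢0 n)

poch-suc : ∀ a q n → poch a q (suc n) ≡ (1ℚ - a) * poch (a * q) q n
poch-suc a q zero    = 1*[1-a*1]≡[1-a]*1 a
  where
  1*[1-a*1]≡[1-a]*1 : ∀ a → 1ℚ * (1ℚ - a * 1ℚ) ≡ (1ℚ - a) * 1ℚ
  1*[1-a*1]≡[1-a]*1 = solve-∀ ℚ-ring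
poch-suc a q (suc n) = begin
  poch a q (suc n) * (1ℚ - a * (q * q ^ n))            ≡⟨ cong (_* (1ℚ - a * (q * q ^ n))) (poch-suc a q n) ⟩
  (1ℚ - a) * poch (a * q) q n * (1ℚ - a * (q * q ^ n)) ≡⟨ regroup a q (poch (a * q) q n) (q ^ n) ⟩
  (1ℚ - a) * (poch (a * q) q n * (1ℚ - a * q * q ^ n)) ∎
  where
  open ≡-Reasoning
  regroup : ∀ a q P x → (1ℚ - a) * P * (1ℚ - a * (q * x)) ≡ (1ℚ - a) * (P * (1ℚ - a * q * x))
  regroup = solve-∀ ℚ-ring

1--q²x≡1+q[qx] : ∀ q x → 1ℚ - - (q * q) * x ≡ 1ℚ + q * (q * x)
1--q²x≡1+q[qx] = solve-∀ ℚ-ring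

module _ (q : ℚ) (q≢1 : q ≢ 1ℚ) (q≢-1 : q ≢ - 1ℚ) where

  ∣q∣≢1 : ∣ q ∣ ≢ 1ℚ
  ∣q∣≢1 ∣q∣≡1 with ∣p∣≡p∨∣p∣≡-p q
  ... | inj₁ ∣q∣≡q  = q≢1 (trans (sym ∣q∣≡q) ∣q∣≡1)
  ... | inj₂ ∣q∣≡-q = q≢-1 (trans (sym (⁻¹-involutive q)) (cong -_ (trans (sym ∣q∣≡-q) ∣q∣≡1)))

  ∣q^[1+m]∣≢1 : ∀ m → ∣ q ^ suc m ∣ ≢ 1ℚ
  ∣q^[1+m]∣≢1 m eq =
    ∣q∣≢1 (x^[1+n]≡1⇒x≡1 ∣ q ∣ {{∣-∣-nonNeg q}} m (trans (sym (∣p^n∣≡∣p∣^n q (suc m))) eq))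

  1-q^[1+m]≢0 : ∀ m → 1ℚ - q ^ suc m ≢ 0ℚ
  1-q^[1+m]≢0 m eq = ∣q^[1+m]∣≢1 m (cong ∣_∣ (sym (x∙y⁻¹≈ε⇒x≈y 1ℚ (q ^ suc m) eq)))

  1+q^[1+m]≢0 : ∀ m → 1ℚ + q ^ suc m ≢ 0ℚ
  1+q^[1+m]≢0 m eq = ∣q^[1+m]∣≢1 m (cong ∣_∣ (inverseʳ-unique 1ℚ (q ^ suc m) eq))

  [q,q]≢0 : ∀ n → poch q q n ≢ 0ℚ
  [q,q]≢0 = poch-≢0 1-q^[1+m]≢0

  [-q²,q]≢0 : ∀ n → poch (- (q * q)) q n ≢ 0ℚ
  [-q²,q]≢0 = poch-≢0 (λ j eq → 1+q^[1+m]≢0 (suc j) (trans (sym (1--q²x≡1+q[qx] q (q ^ j))) eq))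

  lead : ℕ → ℚ
  lead n = (q ^ n * (1ℚ + q)) ⊘ (1ℚ + q ^ suc n)

  coeff : ℕ → ℚ
  coeff n = poch q q n ⊘ poch (- (q * q)) q n

  ratio : ℕ → ℚ
  ratio m = poch (- q) q m ⊘ poch q q m

  altSum : ℕ → ℚ
  altSum n = Σ< n (λ j → sgn j * q ^ (suc n ∸ j ∸ 2) * ratio (suc n ∸ j ∸ 2))

  closedForm : ℕ → ℚ
  closedForm n = lead n - coeff n * altSum n

  altSum-suc : ∀ n → altSum (suc n) ≡ q ^ n * ratio n - altSum n
  altSum-suc n = trans (Σ<-suc n _) (cong₂ _+_ (1*a*b≡a*b (q ^ n) (ratio n))
    (trans (Σ<-cong n (λ j → -s*a*b≡-[s*a*b] (sgn j) _ _)) (Σ<-neg n _)))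
    where
    1*a*b≡a*b : ∀ a b → 1ℚ * a * b ≡ a * b
    1*a*b≡a*b = solve-∀ ℚ-ring
    -s*a*b≡-[s*a*b] : ∀ s a b → - s * a * b ≡ - (s * a * b)
    -s*a*b≡-[s*a*b] = solve-∀ ℚ-ring

  [-q,q]⊘[-q²,q] : ∀ n → poch (- q) q n ⊘ poch (- (q * q)) q n ≡ (1ℚ + q) ⊘ (1ℚ + q ^ suc n)
  [-q,q]⊘[-q²,q] n = ⊘-cross ([-q²,q]≢0 n) (1+q^[1+m]≢0 n) (begin
    poch (- q) q n * (1ℚ + q * q ^ n)   ≡⟨ cong (poch (- q) q n *_) (1+qx≡1--qx q (q ^ n)) ⟩
    poch (- q) q (suc n)                ≡⟨ poch-suc (- q) q n ⟩
    (1ℚ - - q) * poch (- q * q) q n     ≡⟨ cong₂ (λ a b → a * poch b q n) (1--q≡1+q q) (-q*q≡-[q*q] q) ⟩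
    (1ℚ + q) * poch (- (q * q)) q n     ∎)
    where
    open ≡-Reasoning
    1+qx≡1--qx : ∀ q x → 1ℚ + q * x ≡ 1ℚ - - q * x
    1+qx≡1--qx = solve-∀ ℚ-ring
    1--q≡1+q : ∀ q → 1ℚ - - q ≡ 1ℚ + q
    1--q≡1+q = solve-∀ ℚ-ring
    -q*q≡-[q*q] : ∀ q → - q * q ≡ - (q * q)
    -q*q≡-[q*q] = solve-∀ ℚ-ring

  coeff-suc : ∀ n → coeff (suc n) * (1ℚ + q ^ suc (suc n)) ≡ coeff n * (1ℚ - q ^ suc n)
  coeff-suc n = begin
    coeff (suc n) * (1ℚ + q * (q * q ^ n))     ≡⟨ cong (coeff (suc n) *_) (1--q²x≡1+q[qx] q (q ^ n)) ⟨
    coeff (suc n) * (1ℚ - - (q * q) * q ^ n)   ≡⟨ p*a⊘r*b*b≡p⊘r*a (poch q q n) (1ℚ - q ^ suc n)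
                                                    ([-q²,q]≢0 n) ([-q²,q]≢0 (suc n)) ⟩
    coeff n * (1ℚ - q ^ suc n)                 ∎
    where open ≡-Reasoning

  coeff*q^n*ratio≡lead : ∀ n → coeff n * q ^ n * ratio n ≡ lead n
  coeff*q^n*ratio≡lead n = begin
    coeff n * q ^ n * ratio n                          ≡⟨ xy∙z≈y∙xz (coeff n) (q ^ n) (ratio n) ⟩
    q ^ n * (coeff n * ratio n)                        ≡⟨ cong (q ^ n *_) (p⊘r*u⊘p≡u⊘r _ ([q,q]≢0 n) ([-q²,q]≢0 n)) ⟩
    q ^ n * (poch (- q) q n ⊘ poch (- (q * q)) q n)    ≡⟨ cong (q ^ n *_) ([-q,q]⊘[-q²,q] n) ⟩
    q ^ n * ((1ℚ + q) ⊘ (1ℚ + q ^ suc n))              ≡⟨ p*[u⊘r]≡p*u⊘r (q ^ n) (1ℚ + q) (1+q^[1+m]≢0 n) ⟩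
    lead n                                             ∎
    where open ≡-Reasoning

  closedForm-suc : ∀ n → closedForm (suc n) * (1ℚ + q ^ suc (suc n))
                       ≡ (q ^ suc n - 1ℚ) * closedForm n + q ^ suc n * (1ℚ + q)
  closedForm-suc n = begin
    (lead (suc n) - coeff (suc n) * altSum (suc n)) * D
      ≡⟨ expand (lead (suc n)) (coeff (suc n)) (altSum (suc n)) D ⟩
    lead (suc n) * D - coeff (suc n) * D * altSum (suc n)
      ≡⟨ cong₂ (λ a c → a - c * altSum (suc n)) (p⊘r*r≡p _ (1+q^[1+m]≢0 (suc n))) (coeff-suc n) ⟩
    y * (1ℚ + q) - coeff n * (1ℚ - y) * altSum (suc n)
      ≡⟨ cong (λ s → y * (1ℚ + q) - coeff n * (1ℚ - y) * s) (altSum-suc n) ⟩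
    y * (1ℚ + q) - coeff n * (1ℚ - y) * (q ^ n * ratio n - altSum n)
      ≡⟨ regroup y (coeff n) (q ^ n) (ratio n) (altSum n) (y * (1ℚ + q)) ⟩
    (y - 1ℚ) * (coeff n * q ^ n * ratio n - coeff n * altSum n) + y * (1ℚ + q)
      ≡⟨ cong (λ a → (y - 1ℚ) * (a - coeff n * altSum n) + y * (1ℚ + q)) (coeff*q^n*ratio≡lead n) ⟩
    (y - 1ℚ) * closedForm n + y * (1ℚ + q)
      ∎
    where
    open ≡-Reasoning
    y = q ^ suc n
    D = 1ℚ + q ^ suc (suc n)
    expand : ∀ a c s d → (a - c * s) * d ≡ a * d - c * d * s
    expand = solve-∀ ℚ-ring
    regroup : ∀ y c x r s t → t - c * (1ℚ - y) * (x * r - s) ≡ (y - 1ℚ) * (c * x * r - c * s) + t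
    regroup = solve-∀ ℚ-ring

  lead-zero : lead 0 ≡ 1ℚ
  lead-zero = ⊘-unique (1+q^[1+m]≢0 0) (1*[1+q*1]≡1*[1+q] q)
    where
    1*[1+q*1]≡1*[1+q] : ∀ q → 1ℚ * (1ℚ + q * 1ℚ) ≡ 1ℚ * (1ℚ + q)
    1*[1+q*1]≡1*[1+q] = solve-∀ ℚ-ring

  Pbar≡closedForm : ∀ n → Pbar q n ≡ closedForm n
  Pbar≡closedForm zero    = sym (trans (cong (_- coeff 0 * 0ℚ) lead-zero) (1-c*0≡1 (coeff 0)))
    where
    1-c*0≡1 : ∀ c → 1ℚ - c * 0ℚ ≡ 1ℚ
    1-c*0≡1 = solve-∀ ℚ-ring
  Pbar≡closedForm (suc n) = ⊘-unique (1+q^[1+m]≢0 (suc n)) (trans (closedForm-suc n)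
    (cong (λ p → (q ^ suc n - 1ℚ) * p + q ^ suc n * (1ℚ + q)) (sym (Pbar≡closedForm n))))

theorem2p2 : (q : ℚ) → q ≢ 1ℚ → q ≢ - 1ℚ → (k : ℕ) → 1 ≤ k →
    Pbar q (k ∸ 1) ≡
      (q ^ (k ∸ 1) * (1ℚ + q)) ⊘ (1ℚ + q ^ k)
      - (poch q q (k ∸ 1) ⊘ poch (- (q * q)) q (k ∸ 1))
        * Σ< (k ∸ 1) (λ j → sgn j * q ^ (k ∸ j ∸ 2)
                         * (poch (- q) q (k ∸ j ∸ 2) ⊘ poch q q (k ∸ j ∸ 2)))
theorem2p2 q q≢1 q≢-1 (suc n) (s≤s _) = Pbar≡closedForm q q≢1 q≢-1 n
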